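{- For every positive integer $n$, if $K_n$ is a complete natural graph on $n$ vertices, then $$\frac{(n+1)!}{2}\le\kappa(K_n).$$
   Context: A natural graph is a simple graph whose vertex set is a finite subset of $\mathbb{N}=\{1,2,\dots\}$. An infinite permutation of $\mathbb{N}$ is a sequence $(\pi(1),\pi(2),\dots)$ in which every positive integer occurs exactly once. For a natural graph $G$, two infinite permutations $\pi,\sigma$ are $G$-different if $\{\pi(i),\sigma(i)\}\in E(G)$ for some $i$. $\kappa(G)$ is the maximum cardinality of a set of pairwise $G$-different infinite permutations. -}

module Defs where

open import Data.Nat using (ℕ; NonZero)
open import Data.Fin using (Fin)
open import Data.Product using (Σ; ∃; _×_)
open import Relation.Binary.PropositionalEquality using (_≡_; _≢_)
open import Relation.Nullary using (¬_)
open import Function.Bundles using (_↔_; Inverse)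
open import Function.Definitions using (Injective)

ℕ⁺ : Set
ℕ⁺ = Σ ℕ NonZero

InfPerm : Set
InfPerm = ℕ⁺ ↔ ℕ⁺

record NaturalGraph : Set₁ where
  field
    size   : ℕ
    vertex : Fin size → ℕ⁺
    vertex-inj : Injective _≡_ _≡_ vertex
    Edge   : ℕ⁺ → ℕ⁺ → Set
    edge-sym   : ∀ {x y} → Edge x y → Edge y x
    edge-irr   : ∀ {x} → ¬ Edge x x
    edge-left  : ∀ {x y} → Edge x y → ∃ λ i → vertex i ≡ x
    edge-right : ∀ {x y} → Edge x y → ∃ λ i → vertex i ≡ y

K : (n : ℕ) (v : Fin n → ℕ⁺) → Injective _≡_ _≡_ v → NaturalGraph
K n v inj = record
  { size = n
  ; vertex = v
  ; vertex-inj = inj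
  ; Edge = λ x y → x ≢ y × (∃ λ i → v i ≡ x) × (∃ λ j → v j ≡ y)
  ; edge-sym = λ { (x≢y , a , b) → (λ e → x≢y (sym' e)) , b , a }
  ; edge-irr = λ { (x≢x , _ , _) → x≢x refl' }
  ; edge-left = λ { (_ , a , _) → a }
  ; edge-right = λ { (_ , _ , b) → b }
  }
  where
  open import Relation.Binary.PropositionalEquality using () renaming (sym to sym'; refl to refl')
  open import Data.Product using (_,_)

GDifferent : NaturalGraph → InfPerm → InfPerm → Set
GDifferent G π σ = ∃ λ (i : ℕ⁺) → NaturalGraph.Edge G (Inverse.to π i) (Inverse.to σ i)

-- m ≤ κ(G): there is a set of m pairwise G-different infinite permutations
-- (indexed by Fin m; G-different permutations are automatically distinct).
κ≥ : NaturalGraph → ℕ → Set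
κ≥ G m = ∃ λ (F : Fin m → InfPerm) → ∀ a b → a ≢ b → GDifferent G (F a) (F b)

module Submission where

-- Adjoin a fresh vertex h to V and let every permutation of V ∪ {h} act on ℕ⁺,
-- fixing all other numbers. If two such permutations are not K_n-different,
-- then at every position they agree or one of them takes the value h, so they
-- differ at most by exchanging h with one other vertex and cannot both be even.
-- Hence the (n+1)!/2 even permutations are pairwise K_n-different. In one-line
-- notation, with h written 0, the permutations of either parity are generated
-- by inserting the largest letter at every position of the permutations of one
-- letter fewer: two permutations with the letter inserted at the same position
-- clash because their predecessors do, and two with it inserted at different
-- positions could only fail to clash by being a transposition of that letter
-- and 0.

open import Defs
open import Data.Nat using (ℕ; zero; suc; _+_; _*_; _∸_; _≤_; _<_; _<ᵇ_; s≤s; _!; parity; NonZero)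
open import Data.Nat.Properties
  using (_≟_; <⇒≢; <-≤-trans; m<n⇒n≢0; 1+n≢0; 1+n≰n; suc-injective; ≤-pred; *-assoc; *-cancelʳ-≡)
open import Data.Nat.DivMod using (_/_; m*n/n≡m)
open import Data.Parity using (Parity; 0ℙ; 1ℙ; _⁻¹) renaming (_+_ to _⊕_)
open import Data.Parity.Properties
  using (+-commutativeSemigroup; +-comm; +-assoc; +-identityʳ; p+p≡0ℙ; p≢p⁻¹; ⁻¹-selfInverse; ⁻¹-involutive; suc-homo-⁻¹)
open import Algebra.Properties.CommutativeSemigroup +-commutativeSemigroup using (x∙yz≈y∙xz; interchange)
open import Data.Bool using (if_then_else_)
open import Data.List using (List; []; _∷_; length; map; concat; tabulate; lookup)
open import Data.List.Properties using (length-++; length-map; length-tabulate; tabulate-cong)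
open import Data.List.Membership.Propositional.Properties using (∈-lookup)
open import Data.List.Relation.Unary.All as All using (All; []; _∷_)
import Data.List.Relation.Unary.All.Properties as All
open import Data.List.Relation.Unary.AllPairs as AllPairs using (AllPairs; []; _∷_)
import Data.List.Relation.Unary.AllPairs.Properties as AllPairs
open import Data.List.Extrema.Nat using (max; xs≤max)
open import Data.Fin using (Fin; toℕ; fromℕ; punchIn) renaming (zero to fzero; suc to fsuc)
open import Data.Fin.Properties using (toℕ<n; toℕ-fromℕ; any?) renaming (_≟_ to _≟ᶠ_)
open import Data.Fin.Permutation using (Permutation′; _⟨$⟩ʳ_; insert; insert-punchIn; flip; inverseˡ; inverseʳ)
import Data.Fin.Permutation as Permutation
open import Data.Vec.Functional using () renaming (_∷_ to _◃_)
open import Data.Product using (∃; _×_; _,_; proj₁; proj₂)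
open import Data.Product.Properties using (≡-dec)
open import Data.Sum using (_⊎_; inj₁; inj₂; [_,_]′)
import Data.Sum as Sum
open import Relation.Nullary using (¬_; yes; no; Dec; contradiction)
open import Relation.Binary.Definitions using (DecidableEquality; Symmetric)
open import Relation.Binary.PropositionalEquality
  using (_≡_; _≢_; refl; sym; trans; cong; cong₂; subst; subst₂; module ≡-Reasoning)
open import Function using (_∘_; id)
open import Function.Bundles using (_↔_; mk↔ₛ′)
open import Function.Definitions using (Injective)

private
  variable
    A : Set
    k m n x y u v : ℕ
    xs ys zs l₁ l₂ L₁ L₂ : List ℕ

-- Inversion parity

[_<_]ℙ : ℕ → ℕ → Parity
[ y < x ]ℙ = if y <ᵇ x then 1ℙ else 0ℙ

parityBelow : ℕ → List ℕ → Parity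
parityBelow x []       = 0ℙ
parityBelow x (y ∷ ys) = [ y < x ]ℙ ⊕ parityBelow x ys

inversionParity : List ℕ → Parity
inversionParity []       = 0ℙ
inversionParity (x ∷ xs) = parityBelow x xs ⊕ inversionParity xs

[<]ℙ-flip : x ≢ y → [ y < x ]ℙ ≡ [ x < y ]ℙ ⁻¹
[<]ℙ-flip {zero}  {zero}  0≢0 = contradiction refl 0≢0
[<]ℙ-flip {zero}  {suc y} _   = refl
[<]ℙ-flip {suc x} {zero}  _   = refl
[<]ℙ-flip {suc x} {suc y} x≢y = [<]ℙ-flip (x≢y ∘ cong suc)

<⇒[<]ℙ≡1ℙ : x < y → [ x < y ]ℙ ≡ 1ℙ
<⇒[<]ℙ≡1ℙ {zero}  {suc y} _         = refl
<⇒[<]ℙ≡1ℙ {suc x} {suc y} (s≤s x<y) = <⇒[<]ℙ≡1ℙ x<y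

<⇒[>]ℙ≡0ℙ : x < y → [ y < x ]ℙ ≡ 0ℙ
<⇒[>]ℙ≡0ℙ {zero}  {suc y} _         = refl
<⇒[>]ℙ≡0ℙ {suc x} {suc y} (s≤s x<y) = <⇒[>]ℙ≡0ℙ x<y

⁻¹-⊕ : ∀ a b → a ⁻¹ ⊕ b ≡ (a ⊕ b) ⁻¹
⁻¹-⊕ = +-assoc 1ℙ

⊕-⁻¹ : ∀ a b → a ⊕ b ⁻¹ ≡ (a ⊕ b) ⁻¹
⊕-⁻¹ a = x∙yz≈y∙xz a 1ℙ

inversionParity-swap : ∀ zs → x ≢ y → inversionParity (x ∷ y ∷ zs) ≡ inversionParity (y ∷ x ∷ zs) ⁻¹
inversionParity-swap {x} {y} zs x≢y = begin
  ([ y < x ]ℙ ⊕ βx) ⊕ (βy ⊕ ι)   ≡⟨ cong (λ a → (a ⊕ βx) ⊕ (βy ⊕ ι)) ([<]ℙ-flip x≢y) ⟩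
  ([ x < y ]ℙ ⁻¹ ⊕ βx) ⊕ (βy ⊕ ι) ≡⟨ interchange ([ x < y ]ℙ ⁻¹) βx βy ι ⟩
  ([ x < y ]ℙ ⁻¹ ⊕ βy) ⊕ (βx ⊕ ι) ≡⟨ cong (_⊕ (βx ⊕ ι)) (⁻¹-⊕ [ x < y ]ℙ βy) ⟩
  ([ x < y ]ℙ ⊕ βy) ⁻¹ ⊕ (βx ⊕ ι) ≡⟨ ⁻¹-⊕ ([ x < y ]ℙ ⊕ βy) (βx ⊕ ι) ⟩
  (([ x < y ]ℙ ⊕ βy) ⊕ (βx ⊕ ι)) ⁻¹ ∎
  where
  open ≡-Reasoning
  βx = parityBelow x zs
  βy = parityBelow y zs
  ι  = inversionParity zs

data FirstReplaced (v u : ℕ) : List ℕ → List ℕ → Set where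
  replace : FirstReplaced v u (v ∷ zs) (u ∷ zs)
  keep    : ∀ {z} → z ≢ u → z ≢ v → FirstReplaced v u l₁ l₂ → FirstReplaced v u (z ∷ l₁) (z ∷ l₂)

-- L₂ is L₁ with an entry u and a later entry v exchanged, no u or v lying between them.
data Transposed (u v : ℕ) : List ℕ → List ℕ → Set where
  here  : FirstReplaced v u l₁ l₂ → Transposed u v (u ∷ l₁) (v ∷ l₂)
  there : Transposed u v L₁ L₂ → Transposed u v (x ∷ L₁) (x ∷ L₂)

parityBelow-firstReplaced : ∀ x → FirstReplaced v u l₁ l₂ → parityBelow x (u ∷ l₁) ≡ parityBelow x (v ∷ l₂)
parityBelow-firstReplaced {v} {u} x (replace {zs = zs}) =
  x∙yz≈y∙xz [ u < x ]ℙ [ v < x ]ℙ (parityBelow x zs)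
parityBelow-firstReplaced {v} {u} x (keep {l₁ = l₁} {l₂ = l₂} {z = z} _ _ r) = begin
  [ u < x ]ℙ ⊕ ([ z < x ]ℙ ⊕ parityBelow x l₁) ≡⟨ x∙yz≈y∙xz [ u < x ]ℙ [ z < x ]ℙ (parityBelow x l₁) ⟩
  [ z < x ]ℙ ⊕ ([ u < x ]ℙ ⊕ parityBelow x l₁) ≡⟨ cong ([ z < x ]ℙ ⊕_) (parityBelow-firstReplaced x r) ⟩
  [ z < x ]ℙ ⊕ ([ v < x ]ℙ ⊕ parityBelow x l₂) ≡⟨ x∙yz≈y∙xz [ z < x ]ℙ [ v < x ]ℙ (parityBelow x l₂) ⟩
  [ v < x ]ℙ ⊕ ([ z < x ]ℙ ⊕ parityBelow x l₂) ∎
  where open ≡-Reasoning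

parityBelow-transposed : ∀ x → Transposed u v L₁ L₂ → parityBelow x L₁ ≡ parityBelow x L₂
parityBelow-transposed x (here r)          = parityBelow-firstReplaced x r
parityBelow-transposed x (there {x = y} t) = cong ([ y < x ]ℙ ⊕_) (parityBelow-transposed x t)

inversionParity-firstReplaced : u ≢ v → FirstReplaced v u l₁ l₂ →
                                inversionParity (u ∷ l₁) ≡ inversionParity (v ∷ l₂) ⁻¹
inversionParity-firstReplaced u≢v (replace {zs = zs}) = inversionParity-swap zs u≢v
inversionParity-firstReplaced {u} {v} u≢v (keep {l₁ = l₁} {l₂ = l₂} {z = z} z≢u z≢v r) = begin
  inversionParity (u ∷ z ∷ l₁)
    ≡⟨ inversionParity-swap l₁ (z≢u ∘ sym) ⟩
  (parityBelow z (u ∷ l₁) ⊕ inversionParity (u ∷ l₁)) ⁻¹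
    ≡⟨ cong₂ (λ a b → (a ⊕ b) ⁻¹) (parityBelow-firstReplaced z r) (inversionParity-firstReplaced u≢v r) ⟩
  (parityBelow z (v ∷ l₂) ⊕ inversionParity (v ∷ l₂) ⁻¹) ⁻¹
    ≡⟨ cong _⁻¹ (⊕-⁻¹ (parityBelow z (v ∷ l₂)) (inversionParity (v ∷ l₂))) ⟩
  (parityBelow z (v ∷ l₂) ⊕ inversionParity (v ∷ l₂)) ⁻¹ ⁻¹
    ≡⟨ ⁻¹-involutive _ ⟩
  inversionParity (z ∷ v ∷ l₂)
    ≡⟨ inversionParity-swap l₂ z≢v ⟩
  inversionParity (v ∷ z ∷ l₂) ⁻¹ ∎
  where open ≡-Reasoning

inversionParity-transposed : u ≢ v → Transposed u v L₁ L₂ → inversionParity L₁ ≡ inversionParity L₂ ⁻¹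
inversionParity-transposed u≢v (here r) = inversionParity-firstReplaced u≢v r
inversionParity-transposed u≢v (there {L₁ = L₁} {L₂ = L₂} {x = y} t) =
  trans (cong₂ _⊕_ (parityBelow-transposed y t) (inversionParity-transposed u≢v t))
        (⊕-⁻¹ (parityBelow y L₂) (inversionParity L₂))

-- Unlike Data.List.insertAt, the position is a natural number; positions past the end append.
insertAt : ℕ → A → List A → List A
insertAt zero    a xs       = a ∷ xs
insertAt (suc p) a []       = a ∷ []
insertAt (suc p) a (x ∷ xs) = x ∷ insertAt p a xs

parityBelow-insertAt : ∀ p xs → x < m → parityBelow x (insertAt p m xs) ≡ parityBelow x xs
parityBelow-insertAt {x} zero    xs       x<m = cong (_⊕ parityBelow x xs) (<⇒[>]ℙ≡0ℙ x<m)
parityBelow-insertAt     (suc p) []       x<m = cong (_⊕ 0ℙ) (<⇒[>]ℙ≡0ℙ x<m)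
parityBelow-insertAt {x} (suc p) (y ∷ xs) x<m = cong ([ y < x ]ℙ ⊕_) (parityBelow-insertAt p xs x<m)

parityBelow-max : All (_< m) xs → parityBelow m xs ≡ parity (length xs)
parityBelow-max []                                   = refl
parityBelow-max {m} {xs = y ∷ xs} (y<m ∷ xs<m) = begin
  [ y < m ]ℙ ⊕ parityBelow m xs ≡⟨ cong₂ _⊕_ (<⇒[<]ℙ≡1ℙ y<m) (parityBelow-max xs<m) ⟩
  parity (length xs) ⁻¹         ≡⟨ ⁻¹-selfInverse (suc-homo-⁻¹ (length xs)) ⟩
  parity (suc (length xs))      ∎
  where open ≡-Reasoning

inversionParity-insertAt-max : ∀ p → All (_< m) xs →
  inversionParity (insertAt p m xs) ≡ inversionParity xs ⊕ parity (length xs ∸ p)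
inversionParity-insertAt-max {m} {xs} zero xs<m =
  trans (cong (_⊕ inversionParity xs) (parityBelow-max xs<m)) (+-comm (parity (length xs)) (inversionParity xs))
inversionParity-insertAt-max (suc p) [] = refl
inversionParity-insertAt-max {m} {x ∷ xs} (suc p) (x<m ∷ xs<m) =
  trans (cong₂ _⊕_ (parityBelow-insertAt p xs x<m) (inversionParity-insertAt-max p xs<m))
        (sym (+-assoc (parityBelow x xs) (inversionParity xs) (parity (length xs ∸ p))))

-- In one-line notation the letter 0 stands for the fresh vertex, so a clash is a
-- position at which two permutations are joined by an edge of the complete graph.

ZeroFree : List ℕ → Set
ZeroFree = All (_≢ 0)

data OneZero : List ℕ → Set where
  here  : ZeroFree xs → OneZero (0 ∷ xs)
  there : x ≢ 0 → OneZero xs → OneZero (x ∷ xs)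

data Clash : List ℕ → List ℕ → Set where
  here  : x ≢ 0 → y ≢ 0 → x ≢ y → Clash (x ∷ xs) (y ∷ ys)
  there : Clash xs ys → Clash (x ∷ xs) (y ∷ ys)

Clash-sym : Symmetric Clash
Clash-sym (here x≢0 y≢0 x≢y) = here y≢0 x≢0 (x≢y ∘ sym)
Clash-sym (there c)           = there (Clash-sym c)

Clash-insertAt : ∀ p → Clash xs ys → Clash (insertAt p m xs) (insertAt p m ys)
Clash-insertAt zero    c                    = there c
Clash-insertAt (suc p) (here x≢0 y≢0 x≢y) = here x≢0 y≢0 x≢y
Clash-insertAt (suc p) (there c)           = there (Clash-insertAt p c)

Clash⊎≡ : ZeroFree xs → ZeroFree ys → length xs ≡ length ys → Clash xs ys ⊎ xs ≡ ys
Clash⊎≡ [] [] _ = inj₂ refl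
Clash⊎≡ {x ∷ xs} {y ∷ ys} (x≢0 ∷ xs≢0) (y≢0 ∷ ys≢0) |xs|≡|ys| with x ≟ y
... | no x≢y  = inj₁ (here x≢0 y≢0 x≢y)
... | yes refl = Sum.map there (cong (x ∷_)) (Clash⊎≡ xs≢0 ys≢0 (suc-injective |xs|≡|ys|))

All-insertAt : ∀ {P : A → Set} {a} p {as} → P a → All P as → All P (insertAt p a as)
All-insertAt zero    Pa Pas         = Pa ∷ Pas
All-insertAt (suc p) Pa []          = Pa ∷ []
All-insertAt (suc p) Pa (Pb ∷ Pas) = Pb ∷ All-insertAt p Pa Pas

OneZero-insertAt : ∀ p → m ≢ 0 → OneZero xs → OneZero (insertAt p m xs)
OneZero-insertAt zero    m≢0 o              = there m≢0 o
OneZero-insertAt (suc p) m≢0 (here xs≢0)    = here (All-insertAt p m≢0 xs≢0)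
OneZero-insertAt (suc p) m≢0 (there x≢0 o) = there x≢0 (OneZero-insertAt p m≢0 o)

module _ {m : ℕ} where

  clash-max : x ≢ 0 → x < m → Clash (x ∷ xs) (m ∷ ys)
  clash-max x≢0 x<m = here x≢0 (m<n⇒n≢0 x<m) (<⇒≢ x<m)

  clash-insertAt : ZeroFree xs → All (_< m) xs → ∀ d ys → d < length xs → Clash xs (insertAt d m ys)
  clash-insertAt (x≢0 ∷ _)   (x<m ∷ _)    zero    ys       _         = clash-max x≢0 x<m
  clash-insertAt (x≢0 ∷ _)   (x<m ∷ _)    (suc d) []       _         = clash-max x≢0 x<m
  clash-insertAt (_ ∷ xs≢0) (_ ∷ xs<m) (suc d) (y ∷ ys) (s≤s d<) = there (clash-insertAt xs≢0 xs<m d ys d<)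

  clash-insertAt-later : ZeroFree xs → All (_< m) xs → ∀ p q ys → p < q → q ≤ length xs → q ≤ length ys →
                         Clash (insertAt p m xs) (insertAt q m ys)
  clash-insertAt-later xs≢0 xs<m zero (suc d) (y ∷ ys) _ q≤ _ = there (clash-insertAt xs≢0 xs<m d ys q≤)
  clash-insertAt-later (_ ∷ xs≢0) (_ ∷ xs<m) (suc p) (suc q) (y ∷ ys) (s≤s p<q) (s≤s q≤) (s≤s q≤′) =
    there (clash-insertAt-later xs≢0 xs<m p q ys p<q q≤ q≤′)

  clash-insertAt-earlier : ZeroFree ys → All (_< m) ys → ∀ p q xs → p < q → p < length ys →
                           Clash (insertAt p m xs) (insertAt q m ys)
  clash-insertAt-earlier (y≢0 ∷ _) (y<m ∷ _) zero (suc q) xs _ _ = Clash-sym (clash-max y≢0 y<m)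
  clash-insertAt-earlier (y≢0 ∷ _) (y<m ∷ _) (suc p) (suc q) [] _ _ = Clash-sym (clash-max y≢0 y<m)
  clash-insertAt-earlier (_ ∷ ys≢0) (_ ∷ ys<m) (suc p) (suc q) (x ∷ xs) (s≤s p<q) (s≤s p<) =
    there (clash-insertAt-earlier ys≢0 ys<m p q xs p<q p<)

  clash⊎firstReplaced : ∀ d → OneZero l₁ → All (_< m) l₁ → ZeroFree l₂ →
    length l₁ ≡ suc (length l₂) → d ≤ length l₂ →
    Clash l₁ (insertAt d m l₂) ⊎ FirstReplaced 0 m l₁ (insertAt d m l₂)
  clash⊎firstReplaced zero (here l₁≢0) _ l₂≢0 |l₁|≡ _ =
    Sum.map there (λ { refl → replace }) (Clash⊎≡ l₁≢0 l₂≢0 (suc-injective |l₁|≡))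
  clash⊎firstReplaced zero (there x≢0 _) (x<m ∷ _) _ _ _ = inj₁ (clash-max x≢0 x<m)
  clash⊎firstReplaced {l₂ = y ∷ l₂} (suc d) (here l₁≢0) (_ ∷ l₁<m) _ |l₁|≡ (s≤s d≤) =
    inj₁ (there (clash-insertAt l₁≢0 l₁<m d l₂ (subst (d <_) (sym (suc-injective |l₁|≡)) (s≤s d≤))))
  clash⊎firstReplaced {x ∷ l₁} {y ∷ l₂} (suc d) (there x≢0 o) (x<m ∷ l₁<m) (y≢0 ∷ l₂≢0) |l₁|≡ (s≤s d≤)
    with x ≟ y
  ... | no x≢y  = inj₁ (here x≢0 y≢0 x≢y)
  ... | yes refl = Sum.map there (keep (<⇒≢ x<m) x≢0)
                     (clash⊎firstReplaced d o l₁<m l₂≢0 (suc-injective |l₁|≡) d≤)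

  clash⊎transposed : ∀ p q → OneZero l₁ → OneZero l₂ → All (_< m) l₁ → All (_< m) l₂ →
    length l₁ ≡ length l₂ → p < q → q ≤ length l₂ →
    Clash (insertAt p m l₁) (insertAt q m l₂) ⊎ Transposed m 0 (insertAt p m l₁) (insertAt q m l₂)
  clash⊎transposed zero (suc d) o₁ (here l₂≢0) l₁<m _ |l₁|≡ _ (s≤s d≤) =
    Sum.map there here (clash⊎firstReplaced d o₁ l₁<m l₂≢0 |l₁|≡ d≤)
  clash⊎transposed zero (suc d) _ (there y≢0 _) _ (y<m ∷ _) _ _ _ = inj₁ (Clash-sym (clash-max y≢0 y<m))
  clash⊎transposed {l₂ = y ∷ l₂} (suc p) (suc q) (here l₁≢0) _ (_ ∷ l₁<m) _ |l₁|≡ (s≤s p<q) (s≤s q≤) =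
    inj₁ (there (clash-insertAt-later l₁≢0 l₁<m p q l₂ p<q (subst (q ≤_) (sym (suc-injective |l₁|≡)) q≤) q≤))
  clash⊎transposed {x ∷ l₁} (suc p) (suc q) (there _ _) (here l₂≢0) _ (_ ∷ l₂<m) _ (s≤s p<q) (s≤s q≤) =
    inj₁ (there (clash-insertAt-earlier l₂≢0 l₂<m p q l₁ p<q (<-≤-trans p<q q≤)))
  clash⊎transposed {x ∷ l₁} {y ∷ l₂} (suc p) (suc q) (there x≢0 o₁) (there y≢0 o₂) (_ ∷ l₁<m) (_ ∷ l₂<m)
    |l₁|≡ (s≤s p<q) (s≤s q≤) with x ≟ y
  ... | no x≢y  = inj₁ (here x≢0 y≢0 x≢y)
  ... | yes refl = Sum.map there there
                     (clash⊎transposed p q o₁ o₂ l₁<m l₂<m (suc-injective |l₁|≡) p<q q≤)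

  clash-insertAt-parity : m ≢ 0 → ∀ p q → OneZero l₁ → OneZero l₂ → All (_< m) l₁ → All (_< m) l₂ →
    length l₁ ≡ length l₂ → p < q → q ≤ length l₂ →
    inversionParity (insertAt p m l₁) ≡ inversionParity (insertAt q m l₂) →
    Clash (insertAt p m l₁) (insertAt q m l₂)
  clash-insertAt-parity m≢0 p q o₁ o₂ l₁<m l₂<m |l₁|≡ p<q q≤ same =
    [ id , (λ t → contradiction (trans (sym same) (inversionParity-transposed m≢0 t)) (p≢p⁻¹ _)) ]′
      (clash⊎transposed p q o₁ o₂ l₁<m l₂<m |l₁|≡ p<q q≤)

-- Permutations by insertion of the largest letter

oneLine : Permutation′ n → List ℕ
oneLine σ = tabulate (toℕ ∘ (σ ⟨$⟩ʳ_))

oneLine-below : (σ : Permutation′ n) → All (_< n) (oneLine σ)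
oneLine-below σ = All.tabulate⁺ (toℕ<n ∘ (σ ⟨$⟩ʳ_))

length-oneLine : (σ : Permutation′ n) → length (oneLine σ) ≡ n
length-oneLine σ = length-tabulate (toℕ ∘ (σ ⟨$⟩ʳ_))

tabulate-insertAt : ∀ (f : Fin (suc n) → A) i → tabulate f ≡ insertAt (toℕ i) (f i) (tabulate (f ∘ punchIn i))
tabulate-insertAt             f fzero    = refl
tabulate-insertAt {n = suc n} f (fsuc i) = cong (f fzero ∷_) (tabulate-insertAt (f ∘ fsuc) i)

insert-self : ∀ i j (π : Permutation′ n) → insert i j π ⟨$⟩ʳ i ≡ j
insert-self i j π with i ≟ᶠ i
... | yes _   = refl
... | no i≢i = contradiction refl i≢i

toℕ-punchIn-fromℕ : ∀ (i : Fin n) → toℕ (punchIn (fromℕ n) i) ≡ toℕ i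
toℕ-punchIn-fromℕ fzero    = refl
toℕ-punchIn-fromℕ (fsuc i) = cong suc (toℕ-punchIn-fromℕ i)

oneLine-insert : ∀ i (σ : Permutation′ n) → oneLine (insert i (fromℕ n) σ) ≡ insertAt (toℕ i) n (oneLine σ)
oneLine-insert {n} i σ =
  trans (tabulate-insertAt (toℕ ∘ (σ′ ⟨$⟩ʳ_)) i) (cong₂ (insertAt (toℕ i)) σ′i (tabulate-cong σ′∘punchIn))
  where
  σ′ = insert i (fromℕ n) σ
  σ′i : toℕ (σ′ ⟨$⟩ʳ i) ≡ n
  σ′i = trans (cong toℕ (insert-self i (fromℕ n) σ)) (toℕ-fromℕ n)
  σ′∘punchIn : ∀ j → toℕ (σ′ ⟨$⟩ʳ punchIn i j) ≡ toℕ (σ ⟨$⟩ʳ j)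
  σ′∘punchIn j = trans (cong toℕ (insert-punchIn i (fromℕ n) σ j)) (toℕ-punchIn-fromℕ (σ ⟨$⟩ʳ j))

-- OneZero holds for every permutation, but carrying it along the recursion is
-- simpler than proving it.
OfParity : Parity → Permutation′ n → Set
OfParity b σ = OneZero (oneLine σ) × inversionParity (oneLine σ) ≡ b

permsOfParity : (k : ℕ) → Parity → List (Permutation′ (suc k))
permsOfParity zero    0ℙ = Permutation.id ∷ []
permsOfParity zero    1ℙ = []
permsOfParity (suc k) b  = concat (tabulate λ i →
  map (insert i (fromℕ (suc k))) (permsOfParity k (b ⊕ parity (suc k ∸ toℕ i))))

insert-ofParity : ∀ b i (σ : Permutation′ (suc k)) →
  OfParity (b ⊕ parity (suc k ∸ toℕ i)) σ → OfParity b (insert i (fromℕ (suc k)) σ)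
insert-ofParity {k} b i σ (o , ισ) =
  subst (λ l → OneZero l × inversionParity l ≡ b) (sym (oneLine-insert i σ))
    (OneZero-insertAt (toℕ i) 1+n≢0 o , parity-insertAt)
  where
  open ≡-Reasoning
  c = parity (suc k ∸ toℕ i)
  parity-insertAt : inversionParity (insertAt (toℕ i) (suc k) (oneLine σ)) ≡ b
  parity-insertAt = begin
    inversionParity (insertAt (toℕ i) (suc k) (oneLine σ))
      ≡⟨ inversionParity-insertAt-max (toℕ i) (oneLine-below σ) ⟩
    inversionParity (oneLine σ) ⊕ parity (length (oneLine σ) ∸ toℕ i)
      ≡⟨ cong₂ (λ a l → a ⊕ parity (l ∸ toℕ i)) ισ (length-oneLine σ) ⟩
    b ⊕ c ⊕ c   ≡⟨ +-assoc b c c ⟩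
    b ⊕ (c ⊕ c) ≡⟨ cong (b ⊕_) (p+p≡0ℙ c) ⟩
    b ⊕ 0ℙ      ≡⟨ +-identityʳ b ⟩
    b           ∎

permsOfParity-ofParity : ∀ k b → All (OfParity b) (permsOfParity k b)
permsOfParity-ofParity zero    0ℙ = (here [] , refl) ∷ []
permsOfParity-ofParity zero    1ℙ = []
permsOfParity-ofParity (suc k) b  = All.concat⁺ (All.tabulate⁺ λ i →
  All.map⁺ {f = insert i (fromℕ (suc k))}
    (All.map (λ {σ} → insert-ofParity b i σ) (permsOfParity-ofParity k _)))

ClashingOneLines : Permutation′ n → Permutation′ n → Set
ClashingOneLines σ τ = Clash (oneLine σ) (oneLine τ)

insert-clash : ∀ {i j} → toℕ i < toℕ j → (σ τ : Permutation′ (suc k)) →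
  OneZero (oneLine σ) → OneZero (oneLine τ) →
  inversionParity (oneLine (insert i (fromℕ (suc k)) σ)) ≡
    inversionParity (oneLine (insert j (fromℕ (suc k)) τ)) →
  ClashingOneLines (insert i (fromℕ (suc k)) σ) (insert j (fromℕ (suc k)) τ)
insert-clash {i = i} {j} i<j σ τ σ-oneZero τ-oneZero same-parity =
  subst₂ Clash (sym (oneLine-insert i σ)) (sym (oneLine-insert j τ))
    (clash-insertAt-parity 1+n≢0 (toℕ i) (toℕ j) σ-oneZero τ-oneZero (oneLine-below σ) (oneLine-below τ)
      (trans (length-oneLine σ) (sym (length-oneLine τ))) i<j
      (subst (toℕ j ≤_) (sym (length-oneLine τ)) (≤-pred (toℕ<n j)))
      (subst₂ (λ L₁ L₂ → inversionParity L₁ ≡ inversionParity L₂) (oneLine-insert i σ) (oneLine-insert j τ)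
        same-parity))

permsOfParity-clash : ∀ k b → AllPairs ClashingOneLines (permsOfParity k b)
permsOfParity-clash zero    0ℙ = [] ∷ []
permsOfParity-clash zero    1ℙ = []
permsOfParity-clash (suc k) b  = AllPairs.concat⁺ (All.tabulate⁺ sameBlock) (AllPairs.tabulate⁺-< acrossBlocks)
  where
  M = fromℕ (suc k)
  bᵢ : Fin (suc (suc k)) → Parity
  bᵢ i = b ⊕ parity (suc k ∸ toℕ i)

  sameBlock : ∀ i → AllPairs ClashingOneLines (map (insert i M) (permsOfParity k (bᵢ i)))
  sameBlock i = AllPairs.map⁺ (AllPairs.map (λ {σ τ} c →
    subst₂ Clash (sym (oneLine-insert i σ)) (sym (oneLine-insert i τ)) (Clash-insertAt (toℕ i) c))
    (permsOfParity-clash k (bᵢ i)))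

  acrossBlocks : ∀ {i j} → toℕ i < toℕ j →
    All (λ σ → All (ClashingOneLines σ) (map (insert j M) (permsOfParity k (bᵢ j))))
        (map (insert i M) (permsOfParity k (bᵢ i)))
  acrossBlocks {i} {j} i<j =
    All.map⁺ {f = insert i M} (All.map (λ {σ} σ-ofParity →
      All.map⁺ {f = insert j M} (All.map (λ {τ} τ-ofParity →
        insert-clash i<j σ τ (proj₁ σ-ofParity) (proj₁ τ-ofParity)
          (trans (proj₂ (insert-ofParity b i σ σ-ofParity)) (sym (proj₂ (insert-ofParity b j τ τ-ofParity)))))
        (permsOfParity-ofParity k (bᵢ j))))
      (permsOfParity-ofParity k (bᵢ i)))

length-concat-tabulate : ∀ (f : Fin n → List A) {c} → (∀ i → length (f i) ≡ c) →
                         length (concat (tabulate f)) ≡ n * c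
length-concat-tabulate {zero}  f     _     = refl
length-concat-tabulate {suc n} f {c} |f|≡c =
  trans (length-++ (f fzero)) (cong₂ _+_ (|f|≡c fzero) (length-concat-tabulate (f ∘ fsuc) (|f|≡c ∘ fsuc)))

length-permsOfParity : ∀ k b → length (permsOfParity (suc k) b) * 2 ≡ suc (suc k) !
length-permsOfParity zero    0ℙ = refl
length-permsOfParity zero    1ℙ = refl
length-permsOfParity (suc k) b  = begin
  length (concat (tabulate block)) * 2 ≡⟨ cong (_* 2) (length-concat-tabulate block |block|≡c) ⟩
  suc (suc (suc k)) * c * 2            ≡⟨ *-assoc (suc (suc (suc k))) c 2 ⟩
  suc (suc (suc k)) * (c * 2)          ≡⟨ cong (suc (suc (suc k)) *_) (length-permsOfParity k 0ℙ) ⟩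
  suc (suc (suc k)) !                  ∎
  where
  open ≡-Reasoning
  c = length (permsOfParity (suc k) 0ℙ)
  block : Fin (suc (suc (suc k))) → List (Permutation′ (suc (suc (suc k))))
  block i = map (insert i (fromℕ (suc (suc k)))) (permsOfParity (suc k) (b ⊕ parity (suc (suc k) ∸ toℕ i)))
  -- By induction both parities have (k+2)!/2 permutations, so all blocks have the same length.
  |block|≡c : ∀ i → length (block i) ≡ c
  |block|≡c i = trans (length-map (insert i (fromℕ (suc (suc k)))) (permsOfParity (suc k) bᵢ))
    (*-cancelʳ-≡ _ c 2 (trans (length-permsOfParity k bᵢ) (sym (length-permsOfParity k 0ℙ))))
    where bᵢ = b ⊕ parity (suc (suc k) ∸ toℕ i)

-- Infinite permutations

Clash-tabulate : ∀ (f g : Fin n → ℕ) → Clash (tabulate f) (tabulate g) →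
                 ∃ λ j → f j ≢ 0 × g j ≢ 0 × f j ≢ g j
Clash-tabulate {suc n} f g (here fj≢0 gj≢0 fj≢gj) = fzero , fj≢0 , gj≢0 , fj≢gj
Clash-tabulate {suc n} f g (there c) with Clash-tabulate (f ∘ fsuc) (g ∘ fsuc) c
... | j , clash = fsuc j , clash

module Extension (_≟ᴬ_ : DecidableEquality A) (e : Fin n → A) (e-injective : Injective _≡_ _≡_ e) where

  private
    extendWith : Permutation′ n → (a : A) → Dec (∃ λ j → e j ≡ a) → A
    extendWith σ a (yes (j , _)) = e (σ ⟨$⟩ʳ j)
    extendWith σ a (no _)        = a

  extend : Permutation′ n → A → A
  extend σ a = extendWith σ a (any? λ j → e j ≟ᴬ a)

  extend-e : ∀ σ j → extend σ (e j) ≡ e (σ ⟨$⟩ʳ j)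
  extend-e σ j with any? (λ i → e i ≟ᴬ e j)
  ... | yes (i , eᵢ≡eⱼ) = cong (λ i → e (σ ⟨$⟩ʳ i)) (e-injective eᵢ≡eⱼ)
  ... | no ∄i          = contradiction (j , refl) ∄i

  extend-outside : ∀ σ a → ¬ (∃ λ j → e j ≡ a) → extend σ a ≡ a
  extend-outside σ a ∄j with any? (λ j → e j ≟ᴬ a)
  ... | yes ∃j = contradiction ∃j ∄j
  ... | no _   = refl

  extend-cancel : ∀ σ τ → (∀ j → τ ⟨$⟩ʳ (σ ⟨$⟩ʳ j) ≡ j) → ∀ a → extend τ (extend σ a) ≡ a
  extend-cancel σ τ τσ≡id a with any? (λ j → e j ≟ᴬ a)
  ... | yes (j , refl) = trans (extend-e τ (σ ⟨$⟩ʳ j)) (cong e (τσ≡id j))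
  ... | no ∄j          = extend-outside τ a ∄j

  extend↔ : Permutation′ n → A ↔ A
  extend↔ σ = mk↔ₛ′ (extend σ) (extend (flip σ))
    (extend-cancel (flip σ) σ (λ _ → inverseʳ σ)) (extend-cancel σ (flip σ) (λ _ → inverseˡ σ))

fresh : (v : Fin n → ℕ⁺) → ∃ λ h → ∀ i → v i ≢ h
fresh v = (suc bound , _) , λ i vᵢ≡h →
  1+n≰n (subst (_≤ bound) (cong proj₁ vᵢ≡h) (All.tabulate⁻ (xs≤max 0 (tabulate (proj₁ ∘ v))) i))
  where bound = max 0 (tabulate (proj₁ ∘ v))

NonZero-irrelevant : ∀ {n} (p q : NonZero n) → p ≡ q
NonZero-irrelevant {suc n} p q = refl

_≟⁺_ : DecidableEquality ℕ⁺
_≟⁺_ = ≡-dec _≟_ (λ p q → yes (NonZero-irrelevant p q))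

GDifferent-sym : ∀ G → Symmetric (GDifferent G)
GDifferent-sym G (i , edge) = i , NaturalGraph.edge-sym G edge

AllPairs-lookup : ∀ {R : A → A → Set} {as} → Symmetric R → AllPairs R as →
                  ∀ {i j} → i ≢ j → R (lookup as i) (lookup as j)
AllPairs-lookup sym (Ra ∷ _)   {fzero}  {fzero}  0≢0 = contradiction refl 0≢0
AllPairs-lookup sym (Ra ∷ _)   {fzero}  {fsuc j} _   = All.lookup Ra (∈-lookup j)
AllPairs-lookup sym (Ra ∷ _)   {fsuc i} {fzero}  _   = sym (All.lookup Ra (∈-lookup i))
AllPairs-lookup sym (_ ∷ Ras) {fsuc i} {fsuc j} i≢j = AllPairs-lookup sym Ras (i≢j ∘ cong fsuc)

κ≥-length : ∀ G {πs} → AllPairs (GDifferent G) πs → κ≥ G (length πs)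
κ≥-length G {πs} different =
  lookup πs , λ a b → AllPairs-lookup (λ {π ρ} → GDifferent-sym G {π} {ρ}) different {a} {b}

module _ (n : ℕ) (v : Fin n → ℕ⁺) (v-injective : Injective _≡_ _≡_ v) where

  private
    h = proj₁ (fresh v)

    vertices : Fin (suc n) → ℕ⁺
    vertices = h ◃ v

    vertices-injective : Injective _≡_ _≡_ vertices
    vertices-injective {fzero}  {fzero}  _ = refl
    vertices-injective {fzero}  {fsuc j} h≡vⱼ = contradiction (sym h≡vⱼ) (proj₂ (fresh v) j)
    vertices-injective {fsuc i} {fzero}  vᵢ≡h = contradiction vᵢ≡h (proj₂ (fresh v) i)
    vertices-injective {fsuc i} {fsuc j} vᵢ≡vⱼ = cong fsuc (v-injective vᵢ≡vⱼ)

    open Extension _≟⁺_ vertices vertices-injective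

    vertex-of-nonzero : ∀ t → toℕ t ≢ 0 → ∃ λ i → v i ≡ vertices t
    vertex-of-nonzero fzero    0≢0 = contradiction refl 0≢0
    vertex-of-nonzero (fsuc i) _   = i , refl

  toInfPerm : Permutation′ (suc n) → InfPerm
  toInfPerm = extend↔

  clash⇒different : ∀ σ τ → ClashingOneLines σ τ →
                    GDifferent (K n v v-injective) (toInfPerm σ) (toInfPerm τ)
  clash⇒different σ τ c with Clash-tabulate (toℕ ∘ (σ ⟨$⟩ʳ_)) (toℕ ∘ (τ ⟨$⟩ʳ_)) c
  ... | j , σj≢0 , τj≢0 , σj≢τj =
    vertices j , subst₂ (NaturalGraph.Edge (K n v v-injective)) (sym (extend-e σ j)) (sym (extend-e τ j))
      ((σj≢τj ∘ cong toℕ ∘ vertices-injective) , vertex-of-nonzero _ σj≢0 , vertex-of-nonzero _ τj≢0)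

proposition2 : (n : ℕ) → 1 ≤ n → (v : Fin n → ℕ⁺) → (inj : Injective _≡_ _≡_ v) →
    κ≥ (K n v inj) ((suc n) ! / 2)
proposition2 (suc n) _ v inj = subst (κ≥ G) count (κ≥-length G different)
  where
  open ≡-Reasoning
  G : NaturalGraph
  G = K (suc n) v inj
  evens : List (Permutation′ (suc (suc n)))
  evens = permsOfParity (suc n) 0ℙ

  different : AllPairs (GDifferent G) (map (toInfPerm (suc n) v inj) evens)
  different = AllPairs.map⁺
    (AllPairs.map (λ {σ τ} → clash⇒different (suc n) v inj σ τ) (permsOfParity-clash (suc n) 0ℙ))

  count : length (map (toInfPerm (suc n) v inj) evens) ≡ suc (suc n) ! / 2
  count = begin
    length (map (toInfPerm (suc n) v inj) evens) ≡⟨ length-map (toInfPerm (suc n) v inj) evens ⟩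
    length evens                                 ≡⟨ m*n/n≡m (length evens) 2 ⟨
    length evens * 2 / 2                         ≡⟨ cong (_/ 2) (length-permsOfParity n 0ℙ) ⟩
    suc (suc n) ! / 2                            ∎
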